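{- Let $b$ be a positive integer and $\omega=e^{2\pi i/3}$. Let $\mathcal M_1=\{3,6\}_{b,0}$ be the regular map on the torus $\mathbb C/b\mathbb Z[\omega]$ and $\mathcal M_2=\{3,6\}_{b,b}$ the regular map on the torus $\mathbb C/(-b+b\omega)\mathbb Z[\omega]$, both induced by the tessellation of $\mathbb C$ by equilateral triangles with vertex set $\mathbb Z[\omega]$ (six triangles at each vertex). Then the pattern of a mirror of a reflection of $\mathcal M_1$ is $(\mathbf{01})^b$ or $(\mathbf{0212})^b$, and the pattern of a mirror of a reflection of $\mathcal M_2$ is $(\mathbf{01})^{3b}$ or $(\mathbf{0212})^b$.
   Context: The geometric points of a map are its vertices (denoted $\mathbf 0$), edge-centres (denoted $\mathbf 1$) and face-centres (denoted $\mathbf 2$). A reflection of the map is an orientation-reversing involutive automorphism; its fixed curves (mirrors) pass through geometric points, and the pattern of a mirror is the cyclic sequence of geometric points met along it, written $(\ell)^K$ to mean the word $\ell$ repeated $K$ times around the closed mirror (here $\ell$ is the minimal repeating block, and $K$ is the link index). -}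

module Defs where

open import Data.Integer as ℤ using (ℤ; +_; -_; _+_; _-_; _*_; ∣_∣)
open import Data.Integer.DivMod using (_%ℕ_)
open import Data.Nat as ℕ using (ℕ; zero; suc; _<_; _≤_)
open import Data.Nat.GCD using (gcd)
open import Data.Bool using (Bool; true; false; if_then_else_)
open import Data.Fin using (Fin; toℕ)
open import Data.Product using (_×_; _,_; ∃)
open import Data.List using (List; []; _∷_; _++_; drop; take; length; concat; replicate; upTo; mapMaybe)
open import Data.Maybe using (Maybe; just; nothing)
open import Relation.Nullary using (¬_)
open import Relation.Binary.PropositionalEquality using (_≡_)

-- Eisenstein integers Z[ω], ω = e^{2πi/3}, ω² = -1 - ω.
-- The pair  a ,ω b  stands for the complex number a + bω.

infix 4 _,ω_

record Zω : Set where
  constructor _,ω_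
  field
    re : ℤ
    im : ℤ
open Zω public

infixl 6 _⊕_ _⊖_
infixl 7 _⊛_ _·_

_⊕_ : Zω → Zω → Zω
(a ,ω b) ⊕ (c ,ω d) = (a + c) ,ω (b + d)

_⊖_ : Zω → Zω → Zω
(a ,ω b) ⊖ (c ,ω d) = (a - c) ,ω (b - d)

-- (a + bω)(c + dω) = (ac - bd) + (ad + bc - bd)ω
_⊛_ : Zω → Zω → Zω
(a ,ω b) ⊛ (c ,ω d) = (a * c - b * d) ,ω (a * d + b * c - b * d)

_·_ : ℤ → Zω → Zω
k · (a ,ω b) = (k * a) ,ω (k * b)

-- complex conjugation: conj(a + bω) = a + bω² = (a - b) - bω
conj : Zω → Zω
conj (a ,ω b) = (a - b) ,ω (- b)

-- ζ = 1 + ω = e^{πi/3}, a primitive 6th root of unity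
ζ : Zω
ζ = + 1 ,ω + 1

one : Zω
one = + 1 ,ω + 0

ζ^ : ℕ → Zω
ζ^ zero = one
ζ^ (suc n) = ζ ⊛ ζ^ n

-- Symmetries of the tessellation of C by equilateral triangles with
-- vertex set Z[ω]:  z ↦ ζ^k · z + t  or  z ↦ ζ^k · conj z + t,
-- with k ∈ {0..5}, t ∈ Z[ω]  (the wallpaper group p6m).

record Sym : Set where
  constructor sym
  field
    rot   : Fin 6
    rev   : Bool      -- true: orientation-reversing (uses conjugation)
    trans : Zω
open Sym public

lin : Sym → Zω → Zω
lin g z = ζ^ (toℕ (rot g)) ⊛ (if rev g then conj z else z)

-- Points of C are handled in "scaled coordinates": x ∈ Z[ω] represents
-- the complex number x/6.  All geometric points (vertices, edge-centres,
-- face-centres) have such coordinates.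
act : Sym → Zω → Zω
act g x = lin g x ⊕ (+ 6) · trans g

-- Lattices L = γ Z[ω] (the torus is C / L).

InL : Zω → Zω → Set
InL γ x = ∃ λ z → x ≡ γ ⊛ z

-- x (in scaled coordinates) lies in L, i.e. x/6 ∈ L
InL6 : Zω → Zω → Set
InL6 γ x = InL ((+ 6) · γ) x

-- Reflection of the map induced on C / γZ[ω]: an automorphism
-- (a tessellation symmetry compatible with L) that is orientation
-- reversing and involutive on the torus.
record IsReflection (γ : Zω) (g : Sym) : Set where
  field
    orientation-reversing : rev g ≡ true
    preserves-L : ∀ x → InL γ x → InL γ (lin g x)
    involutive  : ∀ x → InL6 γ (act g (act g x) ⊖ x)

data GPoint : Set where
  𝟎 𝟏 𝟐 : GPoint    -- vertex, edge-centre, face-centre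

classify′ : ℕ → ℕ → Maybe GPoint
classify′ 0 0 = just 𝟎
classify′ 3 0 = just 𝟏
classify′ 0 3 = just 𝟏
classify′ 3 3 = just 𝟏
classify′ 4 2 = just 𝟐
classify′ 2 4 = just 𝟐
classify′ _ _ = nothing

-- vertices: 6Z[ω]; edge-centres: 6v + 3u (u a unit); face-centres:
-- 6v + 2(2+ω) or 6v + 2(1+2ω)  (centroids of the two kinds of triangles)
classify : Zω → Maybe GPoint
classify (a ,ω b) = classify′ (a %ℕ 6) (b %ℕ 6)

IsGeometric : Zω → Set
IsGeometric x = ∃ λ t → classify x ≡ just t

-- Let g be a reflection of the map on C/L and x₀ a geometric
-- point lying on a mirror of g (g x₀ ≡ x₀ mod L).  The mirror through x₀
-- lifts to the line x₀ + ℝ d, where d is the (primitive, in scaled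
-- coordinates) fixed direction of the linear part of g; its geometric
-- points are among x₀ + k d (k ∈ ℤ), in this order along the line, and
-- the mirror closes up after m steps, m least positive with m d ∈ L.

Primitive : Zω → Set
Primitive d = gcd ∣ re d ∣ ∣ im d ∣ ≡ 1

record MirrorThrough (γ : Zω) (g : Sym) (x₀ d : Zω) (m : ℕ) : Set where
  field
    geometric  : IsGeometric x₀
    on-mirror  : InL6 γ (act g x₀ ⊖ x₀)
    direction  : lin g d ≡ d
    prim-dir   : Primitive d
    period-pos : 1 ≤ m
    period     : InL6 γ ((+ m) · d)
    period-min : ∀ m′ → 1 ≤ m′ → m′ < m → ¬ InL6 γ ((+ m′) · d)

-- the cyclic sequence of geometric points met along the closed mirror,
-- read from x₀ in direction d
patternWord : Zω → Zω → ℕ → List GPoint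
patternWord x₀ d m = mapMaybe (λ k → classify (x₀ ⊕ (+ k) · d)) (upTo m)

rotate : ℕ → List GPoint → List GPoint
rotate i w = drop i w ++ take i w

CyclicEq : List GPoint → List GPoint → Set
CyclicEq w v = ∃ λ i → i ≤ length w × rotate i w ≡ v

_^^_ : List GPoint → ℕ → List GPoint
ℓ ^^ K = concat (replicate K ℓ)

HasPattern : List GPoint → List GPoint → ℕ → Set
HasPattern w ℓ K = CyclicEq w (ℓ ^^ K)

-- {3,6}_{b,0}: torus C / bZ[ω]
γ₁ : ℕ → Zω
γ₁ b = (+ b) ,ω (+ 0)

-- {3,6}_{b,b}: torus C / (-b + bω)Z[ω]
γ₂ : ℕ → Zω
γ₂ b = (- (+ b)) ,ω (+ b)

module Submission where

-- A reflection of either torus lifts to an orientation-reversing symmetry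
-- z ↦ ζᵏ z̄ + t of the triangle tessellation (ζ = 1 + ω, k ∈ {0,…,5}).  The
-- mirror direction d is fixed by z ↦ ζᵏ z̄ and primitive, hence d = ±(axis k)
-- for an explicit primitive axis.  Geometric points are handled in scaled
-- coordinates (x stands for x/6): one lattice step along d is six scaled
-- steps, and the type of a point (vertex, edge-centre, face-centre) depends
-- only on its class modulo 6 Z[ω].

open import Defs

module Mirrors where

  open import Data.Nat as ℕ using (ℕ; zero; suc; _≤_; _<_; s≤s; s≤s⁻¹)
  import Data.Nat.Properties as ℕₚ
  open import Data.Nat.Divisibility using (_∣_; divides; ∣⇒≤; ∣1⇒≡1)
  open import Data.Nat.GCD using (gcd-greatest)
  open import Data.Integer using (ℤ; +_; -_; -[1+_]; _+_; _-_; _*_; ∣_∣)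
  import Data.Integer.Properties as ℤₚ
  open import Data.Integer.DivMod using (_%ℕ_; _/ℕ_; a≡a%ℕn+[a/ℕn]*n; n%ℕd<d)
  open import Data.Integer.Tactic.RingSolver using (solve-∀)
  open import Data.Bool using (true; false)
  open import Data.Empty using (⊥-elim)
  open import Data.Fin using (Fin; zero; suc; toℕ)
  open import Data.Fin.Properties using (all?)
  open import Data.List
    using (List; []; _∷_; _++_; map; take; drop; length; concat; replicate; applyUpTo; upTo; mapMaybe)
  open import Data.List.Properties
    using ( ≡-dec; ++-assoc; ++-identityʳ; take++drop≡id; length-take; length-++-≤ˡ; map-applyUpTo
          ; mapMaybe-++; mapMaybe-map; mapMaybe-cong)
  open import Data.Maybe using (Maybe; just; nothing)
  open import Data.Product using (_×_; _,_; ∃; proj₁; proj₂)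
  open import Data.Sum using (_⊎_; inj₁; inj₂)
  open import Data.Unit using (tt)
  open import Relation.Binary.Definitions using (DecidableEquality)
  open import Relation.Nullary using (Dec; yes; no)
  open import Relation.Nullary.Decidable using (map′; toWitness; _×-dec_; _→-dec_)
  import Relation.Binary.PropositionalEquality as ≡
  open ≡ using (_≡_; refl; cong; cong₂; subst; module ≡-Reasoning)
  open ≡-Reasoning

  -- An equation follows from another one with the same difference of sides;
  -- this is how hypotheses are fed to the ring solver.
  ≡-by-difference : ∀ {a b c d : ℤ} → c - d ≡ a - b → a ≡ b → c ≡ d
  ≡-by-difference {a} {b} {c} {d} same a≡b =
    ℤₚ.i-j≡0⇒i≡j c d (≡.trans same (ℤₚ.i≡j⇒i-j≡0 a≡b))

  remainder-unique : ∀ {r r′} q q′ → r < 6 → r′ < 6 →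
                     + r + q * + 6 ≡ + r′ + q′ * + 6 → r ≡ r′
  remainder-unique {r} {r′} q q′ r<6 r′<6 eq =
    ℤₚ.+-injective (ℤₚ.i-j≡0⇒i≡j (+ r) (+ r′) (ℤₚ.∣i∣≡0⇒i≡0 (small-multiple ∣ q′ - q ∣ ∣gap∣)))
    where
    law : ∀ r r′ q q′ → (r - r′) - (q′ - q) * + 6 ≡ (r + q * + 6) - (r′ + q′ * + 6)
    law = solve-∀
    gap : + r - + r′ ≡ (q′ - q) * + 6
    gap = ≡-by-difference (law (+ r) (+ r′) q q′) eq
    ∣gap∣ : ∣ + r - + r′ ∣ ≡ ∣ q′ - q ∣ ℕ.* 6
    ∣gap∣ = ≡.trans (cong ∣_∣ gap) (ℤₚ.abs-* (q′ - q) (+ 6))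
    gap<6 : ∣ + r - + r′ ∣ < 6
    gap<6 = ℕₚ.≤-<-trans
      (subst (ℕ._≤ r ℕ.⊔ r′) (cong ∣_∣ (≡.sym (ℤₚ.m-n≡m⊖n r r′))) (ℤₚ.∣m⊝n∣≤m⊔n r r′))
      (ℕₚ.⊔-lub r<6 r′<6)
    small-multiple : ∀ k → ∣ + r - + r′ ∣ ≡ k ℕ.* 6 → ∣ + r - + r′ ∣ ≡ 0
    small-multiple zero    eq₀ = eq₀
    small-multiple (suc k) eq₆ =
      ⊥-elim (ℕₚ.<⇒≱ gap<6 (subst (6 ≤_) (≡.sym eq₆) (ℕₚ.m≤m+n 6 (k ℕ.* 6))))

  mod6-congruent : ∀ {i} j k → i ≡ j + + 6 * k → i %ℕ 6 ≡ j %ℕ 6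
  mod6-congruent {i} j k i≡j+6k =
    remainder-unique (i /ℕ 6) (j /ℕ 6 + k) (n%ℕd<d i 6) (n%ℕd<d j 6) (begin
      + (i %ℕ 6) + (i /ℕ 6) * + 6                ≡⟨ a≡a%ℕn+[a/ℕn]*n i 6 ⟨
      i                                          ≡⟨ i≡j+6k ⟩
      j + + 6 * k                                ≡⟨ cong (_+ + 6 * k) (a≡a%ℕn+[a/ℕn]*n j 6) ⟩
      (+ (j %ℕ 6) + (j /ℕ 6) * + 6) + + 6 * k    ≡⟨ regroup (+ (j %ℕ 6)) (j /ℕ 6) k ⟩
      + (j %ℕ 6) + (j /ℕ 6 + k) * + 6            ∎)
    where
    regroup : ∀ r q k → (r + q * + 6) + + 6 * k ≡ r + (q + k) * + 6
    regroup = solve-∀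

  infix 4 _≈₆_
  record _≈₆_ (x y : Zω) : Set where
    constructor via
    field
      multiplier : Zω
      difference : x ≡ y ⊕ (+ 6) · multiplier

  ≈₆-trans : ∀ {x y z} → x ≈₆ y → y ≈₆ z → x ≈₆ z
  ≈₆-trans {z = z} (via k refl) (via l refl) =
    via (l ⊕ k) (cong₂ _,ω_ (law (re z) (re l) (re k)) (law (im z) (im l) (im k)))
    where
    law : ∀ c l k → (c + + 6 * l) + + 6 * k ≡ c + + 6 * (l + k)
    law = solve-∀

  ≈₆-translate : ∀ {x y} u → x ≈₆ y → x ⊕ u ≈₆ y ⊕ u
  ≈₆-translate {y = y} u (via k refl) =
    via k (cong₂ _,ω_ (law (re y) (re k) (re u)) (law (im y) (im k) (im u)))
    where
    law : ∀ c k u → (c + + 6 * k) + u ≡ (c + u) + + 6 * k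
    law = solve-∀

  ≈₆-remainders : ∀ {x y} → x ≈₆ y → re x %ℕ 6 ≡ re y %ℕ 6 × im x %ℕ 6 ≡ im y %ℕ 6
  ≈₆-remainders {y = y} (via k x≡y+6k) =
    mod6-congruent (re y) (re k) (cong re x≡y+6k) , mod6-congruent (im y) (im k) (cong im x≡y+6k)

  classify-≈₆ : ∀ {x y} → x ≈₆ y → classify x ≡ classify y
  classify-≈₆ x≈y = cong₂ classify′ (proj₁ (≈₆-remainders x≈y)) (proj₂ (≈₆-remainders x≈y))

  residue : Zω → Zω
  residue (a ,ω b) = + (a %ℕ 6) ,ω + (b %ℕ 6)

  residue-≈₆ : ∀ x → residue x ≈₆ x
  residue-≈₆ (a ,ω b) = via (- (a /ℕ 6) ,ω - (b /ℕ 6)) (cong₂ _,ω_ (remainder a) (remainder b))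
    where
    law : ∀ r q → r ≡ (r + q * + 6) + + 6 * (- q)
    law = solve-∀
    remainder : ∀ a → + (a %ℕ 6) ≡ a + + 6 * (- (a /ℕ 6))
    remainder a = ≡.trans (law (+ (a %ℕ 6)) (a /ℕ 6))
                          (cong (_+ + 6 * (- (a /ℕ 6))) (≡.sym (a≡a%ℕn+[a/ℕn]*n a 6)))

  mirrorDefect : Zω → Zω → Zω
  mirrorDefect e x = e ⊛ conj x ⊖ x

  -- The defect is additive, so it respects congruence modulo 6.
  mirrorDefect-≈₆ : ∀ e {x y} → x ≈₆ y → mirrorDefect e x ≈₆ mirrorDefect e y
  mirrorDefect-≈₆ (e₁ ,ω e₂) {y = a ,ω b} (via (c ,ω d) refl) =
    via (mirrorDefect (e₁ ,ω e₂) (c ,ω d)) (cong₂ _,ω_ (re-law e₁ e₂ a b c d) (im-law e₁ e₂ a b c d))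
    where
    re-law : ∀ e₁ e₂ a b c d →
      e₁ * ((a + + 6 * c) - (b + + 6 * d)) - e₂ * (- (b + + 6 * d)) - (a + + 6 * c)
      ≡ (e₁ * (a - b) - e₂ * (- b) - a) + + 6 * (e₁ * (c - d) - e₂ * (- d) - c)
    re-law = solve-∀
    im-law : ∀ e₁ e₂ a b c d →
      e₁ * (- (b + + 6 * d)) + e₂ * ((a + + 6 * c) - (b + + 6 * d))
        - e₂ * (- (b + + 6 * d)) - (b + + 6 * d)
      ≡ (e₁ * (- b) + e₂ * (a - b) - e₂ * (- b) - b) + + 6 * (e₁ * (- d) + e₂ * (c - d) - e₂ * (- d) - d)
    im-law = solve-∀

  on-mirror-≈₆ : ∀ {γ e t x} → InL6 γ ((e ⊛ conj x ⊕ (+ 6) · t) ⊖ x) →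
                 mirrorDefect e x ≈₆ (+ 0 ,ω + 0)
  on-mirror-≈₆ {g₁ ,ω g₂} {e} {t₁ ,ω t₂} {x} ((z₁ ,ω z₂) , on-mirror) =
    via ((g₁ ,ω g₂) ⊛ (z₁ ,ω z₂) ⊖ (t₁ ,ω t₂))
      (cong₂ _,ω_ (≡-by-difference (re-law (re (e ⊛ conj x)) (re x) t₁ g₁ g₂ z₁ z₂) (cong re on-mirror))
                  (≡-by-difference (im-law (im (e ⊛ conj x)) (im x) t₂ g₁ g₂ z₁ z₂) (cong im on-mirror)))
    where
    re-law : ∀ E x t g₁ g₂ z₁ z₂ →
      (E - x) - (+ 0 + + 6 * ((g₁ * z₁ - g₂ * z₂) - t))
      ≡ ((E + + 6 * t) - x) - ((+ 6 * g₁) * z₁ - (+ 6 * g₂) * z₂)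
    re-law = solve-∀
    im-law : ∀ E x t g₁ g₂ z₁ z₂ →
      (E - x) - (+ 0 + + 6 * ((g₁ * z₂ + g₂ * z₁ - g₂ * z₂) - t))
      ≡ ((E + + 6 * t) - x) - ((+ 6 * g₁) * z₂ + (+ 6 * g₂) * z₁ - (+ 6 * g₂) * z₂)
    im-law = solve-∀

  six-steps-≈₆ : ∀ x d k → x ⊕ (+ (6 ℕ.+ k)) · d ≈₆ x ⊕ (+ k) · d
  six-steps-≈₆ x d k = via d (cong₂ _,ω_ (law (re x) (+ k) (re d)) (law (im x) (+ k) (im d)))
    where
    law : ∀ a k p → a + (+ 6 + k) * p ≡ (a + k * p) + + 6 * p
    law = solve-∀

  patternWord-residue : ∀ x d m → patternWord x d m ≡ patternWord (residue x) d m
  patternWord-residue x d m =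
    mapMaybe-cong (λ k → ≡.sym (classify-≈₆ (≈₆-translate ((+ k) · d) (residue-≈₆ x)))) (upTo m)

  upTo-+ : ∀ n m → upTo (n ℕ.+ m) ≡ upTo n ++ map (n ℕ.+_) (upTo m)
  upTo-+ n m =
    ≡.trans (applyUpTo-+ (λ i → i) n) (cong (upTo n ++_) (≡.sym (map-applyUpTo (λ i → i) (n ℕ.+_) m)))
    where
    applyUpTo-+ : ∀ (f : ℕ → ℕ) n →
                  applyUpTo f (n ℕ.+ m) ≡ applyUpTo f n ++ applyUpTo (λ i → f (n ℕ.+ i)) m
    applyUpTo-+ f zero    = refl
    applyUpTo-+ f (suc n) = cong (f 0 ∷_) (applyUpTo-+ (λ i → f (suc i)) n)

  periodic-reading : ∀ {B : Set} (f : ℕ → Maybe B) n → (∀ k → f (n ℕ.+ k) ≡ f k) →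
                     ∀ M → mapMaybe f (upTo (M ℕ.* n)) ≡ concat (replicate M (mapMaybe f (upTo n)))
  periodic-reading f n periodic zero    = refl
  periodic-reading f n periodic (suc M) = begin
    mapMaybe f (upTo (n ℕ.+ M ℕ.* n))
      ≡⟨ cong (mapMaybe f) (upTo-+ n (M ℕ.* n)) ⟩
    mapMaybe f (upTo n ++ map (n ℕ.+_) (upTo (M ℕ.* n)))
      ≡⟨ mapMaybe-++ f (upTo n) _ ⟩
    mapMaybe f (upTo n) ++ mapMaybe f (map (n ℕ.+_) (upTo (M ℕ.* n)))
      ≡⟨ cong (mapMaybe f (upTo n) ++_) (≡.trans (mapMaybe-map f (n ℕ.+_) (upTo (M ℕ.* n)))
                                                 (mapMaybe-cong periodic (upTo (M ℕ.* n)))) ⟩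
    mapMaybe f (upTo n) ++ mapMaybe f (upTo (M ℕ.* n))
      ≡⟨ cong (mapMaybe f (upTo n) ++_) (periodic-reading f n periodic M) ⟩
    mapMaybe f (upTo n) ++ concat (replicate M (mapMaybe f (upTo n))) ∎

  window : Zω → Zω → List GPoint
  window x d = patternWord x d 6

  patternWord-periodic : ∀ x d M → patternWord x d (M ℕ.* 6) ≡ window x d ^^ M
  patternWord-periodic x d =
    periodic-reading (λ k → classify (x ⊕ (+ k) · d)) 6 (λ k → classify-≈₆ (six-steps-≈₆ x d k))

  -- Rotations of powers.  The pattern of a mirror is read off a power of the
  -- window, and a rotation of the window onto the motif rotates every copy.
  take-length-++ : ∀ {A : Set} (u v : List A) → take (length u) (u ++ v) ≡ u
  take-length-++ []      v = refl
  take-length-++ (x ∷ u) v = cong (x ∷_) (take-length-++ u v)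

  drop-length-++ : ∀ {A : Set} (u v : List A) → drop (length u) (u ++ v) ≡ v
  drop-length-++ []      v = refl
  drop-length-++ (x ∷ u) v = drop-length-++ u v

  power-shift : ∀ {A : Set} (u v : List A) n →
    concat (replicate n (u ++ v)) ++ u ≡ u ++ concat (replicate n (v ++ u))
  power-shift u v zero    = ≡.sym (++-identityʳ u)
  power-shift u v (suc n) = begin
    ((u ++ v) ++ P) ++ u   ≡⟨ ++-assoc (u ++ v) P u ⟩
    (u ++ v) ++ (P ++ u)   ≡⟨ cong ((u ++ v) ++_) (power-shift u v n) ⟩
    (u ++ v) ++ (u ++ Q)   ≡⟨ ++-assoc u v (u ++ Q) ⟩
    u ++ (v ++ (u ++ Q))   ≡⟨ cong (u ++_) (≡.sym (++-assoc v u Q)) ⟩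
    u ++ ((v ++ u) ++ Q)   ∎
    where
    P = concat (replicate n (u ++ v))
    Q = concat (replicate n (v ++ u))

  rotate-power : ∀ (u v : List GPoint) n → rotate (length u) ((u ++ v) ^^ suc n) ≡ (v ++ u) ^^ suc n
  rotate-power u v n = begin
    rotate (length u) ((u ++ v) ++ P)  ≡⟨ cong (rotate (length u)) (++-assoc u v P) ⟩
    rotate (length u) (u ++ (v ++ P))  ≡⟨ cong₂ _++_ (drop-length-++ u _) (take-length-++ u _) ⟩
    (v ++ P) ++ u                      ≡⟨ ++-assoc v P u ⟩
    v ++ (P ++ u)                      ≡⟨ cong (v ++_) (power-shift u v n) ⟩
    v ++ (u ++ Q)                      ≡⟨ ≡.sym (++-assoc v u Q) ⟩
    (v ++ u) ++ Q                      ∎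
    where
    P = (u ++ v) ^^ n
    Q = (v ++ u) ^^ n

  cyclic-power : ∀ {w ℓ} K → 1 ≤ K → CyclicEq w ℓ → CyclicEq (w ^^ K) (ℓ ^^ K)
  cyclic-power {w} {ℓ} (suc n) _ (j , j≤|w| , rotated) =
    j , ℕₚ.≤-trans j≤|w| (length-++-≤ˡ w) , (begin
      rotate j (w ^^ suc n)
        ≡⟨ cong₂ (λ i w′ → rotate i (w′ ^^ suc n)) |u|≡j (take++drop≡id j w) ⟨
      rotate (length u) ((u ++ v) ^^ suc n)  ≡⟨ rotate-power u v n ⟩
      (v ++ u) ^^ suc n                      ≡⟨ cong (_^^ suc n) rotated ⟩
      ℓ ^^ suc n                             ∎)
    where
    u = take j w
    v = drop j w
    |u|≡j : length u ≡ j
    |u|≡j = ≡.trans (length-take j w) (ℕₚ.m≤n⇒m⊓n≡m j≤|w|)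

  -- The mirror direction.  The vectors fixed by z ↦ ζᵏ z̄ are the integer
  -- multiples of a primitive axis, and primitivity leaves only ± the axis.
  axis : Fin 6 → Zω
  axis zero                                = + 1 ,ω + 0
  axis (suc zero)                          = + 2 ,ω + 1
  axis (suc (suc zero))                    = + 1 ,ω + 1
  axis (suc (suc (suc zero)))              = + 1 ,ω + 2
  axis (suc (suc (suc (suc zero))))        = + 0 ,ω + 1
  axis (suc (suc (suc (suc (suc zero)))))  = + 1 ,ω - + 1

  fixed-on-axis : ∀ k {d} → ζ^ (toℕ k) ⊛ conj d ≡ d → ∃ λ x → d ≡ x · axis k
  fixed-on-axis zero {p ,ω q} fixed =
    p , cong₂ _,ω_ (≡.sym (ℤₚ.*-identityʳ p)) (≡-by-difference (law p q) (≡.sym (cong re fixed)))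
    where
    law : ∀ p q → q - p * + 0 ≡ p - (+ 1 * (p - q) - + 0 * (- q))
    law = solve-∀
  fixed-on-axis (suc zero) {p ,ω q} fixed =
    q , cong₂ _,ω_ (≡-by-difference (law p q) (cong im fixed)) (≡.sym (ℤₚ.*-identityʳ q))
    where
    law : ∀ p q → p - q * + 2 ≡ (+ 1 * (- q) + + 1 * (p - q) - + 1 * (- q)) - q
    law = solve-∀
  fixed-on-axis (suc (suc zero)) {p ,ω q} fixed =
    p , cong₂ _,ω_ (≡.sym (ℤₚ.*-identityʳ p)) (≡-by-difference (law p q) (cong re fixed))
    where
    law : ∀ p q → q - p * + 1 ≡ (+ 0 * (p - q) - + 1 * (- q)) - p
    law = solve-∀
  fixed-on-axis (suc (suc (suc zero))) {p ,ω q} fixed =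
    p , cong₂ _,ω_ (≡.sym (ℤₚ.*-identityʳ p)) (≡-by-difference (law p q) (cong re fixed))
    where
    law : ∀ p q → q - p * + 2 ≡ (- + 1 * (p - q) - + 0 * (- q)) - p
    law = solve-∀
  fixed-on-axis (suc (suc (suc (suc zero)))) {p ,ω q} fixed =
    q , cong₂ _,ω_ (≡-by-difference (law p q) (≡.sym (cong im fixed))) (≡.sym (ℤₚ.*-identityʳ q))
    where
    law : ∀ p q → p - q * + 0 ≡ q - (- + 1 * (- q) + - + 1 * (p - q) - - + 1 * (- q))
    law = solve-∀
  fixed-on-axis (suc (suc (suc (suc (suc zero))))) {p ,ω q} fixed =
    p , cong₂ _,ω_ (≡.sym (ℤₚ.*-identityʳ p)) (≡-by-difference (law p q) (≡.sym (cong re fixed)))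
    where
    law : ∀ p q → q - p * - + 1 ≡ p - (+ 0 * (p - q) - - + 1 * (- q))
    law = solve-∀

  Unit : ℤ → Set
  Unit x = x ≡ + 1 ⊎ x ≡ - + 1

  abs-one-unit : ∀ x → ∣ x ∣ ≡ 1 → Unit x
  abs-one-unit (+ .1)     refl = inj₁ refl
  abs-one-unit -[1+ .0 ]  refl = inj₂ refl

  -- x divides both coordinates of x·u, so a primitive x·u forces x = ±1.
  primitive-multiple : ∀ x u → Primitive (x · u) → Unit x
  primitive-multiple x u prim =
    abs-one-unit x (∣1⇒≡1 (subst (∣ x ∣ ∣_) prim
      (gcd-greatest (divides-coordinate (re u)) (divides-coordinate (im u)))))
    where
    divides-coordinate : ∀ a → ∣ x ∣ ∣ ∣ x * a ∣
    divides-coordinate a = divides ∣ a ∣ (≡.trans (ℤₚ.abs-* x a) (ℕₚ.*-comm ∣ x ∣ ∣ a ∣))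

  mirror-direction : ∀ {γ k t x₀ d m} → MirrorThrough γ (sym k true t) x₀ d m →
                     ∃ λ x → Unit x × d ≡ x · axis k
  mirror-direction {k = k} mirror with fixed-on-axis k (MirrorThrough.direction mirror)
  ... | x , refl = x , primitive-multiple x (axis k) (MirrorThrough.prim-dir mirror) , refl

  -- The two kinds of mirrors: for k even the axis runs along triangle edges
  -- (meeting vertices and edge-centres), for k odd along altitudes.
  data MirrorKind : Set where
    edge-mirror face-mirror : MirrorKind

  kind : Fin 6 → MirrorKind
  kind zero                                = edge-mirror
  kind (suc zero)                          = face-mirror
  kind (suc (suc zero))                    = edge-mirror
  kind (suc (suc (suc zero)))              = face-mirror
  kind (suc (suc (suc (suc zero))))        = edge-mirror
  kind (suc (suc (suc (suc (suc zero)))))  = face-mirror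

  motif : MirrorKind → List GPoint
  motif edge-mirror = 𝟎 ∷ 𝟏 ∷ []
  motif face-mirror = 𝟎 ∷ 𝟐 ∷ 𝟏 ∷ 𝟐 ∷ []

  Divisible6 : Zω → Set
  Divisible6 y = re y %ℕ 6 ≡ 0 × im y %ℕ 6 ≡ 0

  MotifAt : Fin 6 → ℤ → ℕ → ℕ → Set
  MotifAt k σ r s =
    IsGeometric x → Divisible6 (mirrorDefect (ζ^ (toℕ k)) x) →
    CyclicEq (window x (σ · axis k)) (motif (kind k))
    where
    x = + r ,ω + s

  -- Deciding each condition makes the check a computation.
  _≟ᴳ_ : DecidableEquality GPoint
  𝟎 ≟ᴳ 𝟎 = yes refl
  𝟏 ≟ᴳ 𝟏 = yes refl
  𝟐 ≟ᴳ 𝟐 = yes refl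
  𝟎 ≟ᴳ 𝟏 = no λ ()
  𝟎 ≟ᴳ 𝟐 = no λ ()
  𝟏 ≟ᴳ 𝟎 = no λ ()
  𝟏 ≟ᴳ 𝟐 = no λ ()
  𝟐 ≟ᴳ 𝟎 = no λ ()
  𝟐 ≟ᴳ 𝟏 = no λ ()

  geometric? : ∀ x → Dec (IsGeometric x)
  geometric? x with classify x
  ... | just t  = yes (t , refl)
  ... | nothing = no λ { (_ , ()) }

  cyclicEq? : ∀ w v → Dec (CyclicEq w v)
  cyclicEq? w v =
    map′ (λ { (i , i<1+|w| , e) → i , s≤s⁻¹ i<1+|w| , e }) (λ { (i , i≤|w| , e) → i , s≤s i≤|w| , e })
         (ℕₚ.anyUpTo? (λ i → ≡-dec _≟ᴳ_ (rotate i w) v) (suc (length w)))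

  motifAt? : ∀ k σ r s → Dec (MotifAt k σ r s)
  motifAt? k σ r s =
    geometric? x →-dec (re y %ℕ 6 ℕ.≟ 0 ×-dec im y %ℕ 6 ℕ.≟ 0) →-dec
    cyclicEq? (window x (σ · axis k)) (motif (kind k))
    where
    x = + r ,ω + s
    y = mirrorDefect (ζ^ (toℕ k)) x

  -- The table of all 6·6·6·2 cases, evaluated by the type checker.
  motif-table : ∀ k {r} → r < 6 → ∀ {s} → s < 6 → MotifAt k (+ 1) r s × MotifAt k (- + 1) r s
  motif-table = toWitness {a? = all? λ k → ℕₚ.allUpTo? (λ r → ℕₚ.allUpTo? (λ s →
    motifAt? k (+ 1) r s ×-dec motifAt? k (- + 1) r s) 6) 6} tt

  motif-everywhere : ∀ k {σ r s} → Unit σ → r < 6 → s < 6 → MotifAt k σ r s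
  motif-everywhere k (inj₁ refl) r<6 s<6 = proj₁ (motif-table k r<6 s<6)
  motif-everywhere k (inj₂ refl) r<6 s<6 = proj₂ (motif-table k r<6 s<6)

  -- Every mirror closing up after 6M steps has pattern (motif)ᴹ: its reading
  -- is M copies of the window at the residue of x₀, which the finite check
  -- identifies as a rotation of the motif.
  mirror-pattern : ∀ {γ k t x₀ d} M → 1 ≤ M → MirrorThrough γ (sym k true t) x₀ d (M ℕ.* 6) →
                   HasPattern (patternWord x₀ d (M ℕ.* 6)) (motif (kind k)) M
  mirror-pattern {γ} {k} {t} {x₀} M 1≤M mirror with mirror-direction mirror
  ... | σ , unit , refl =
    subst (λ w → CyclicEq w (motif (kind k) ^^ M)) (≡.sym reading) (cyclic-power M 1≤M window-motif)
    where
    open MirrorThrough mirror using (geometric; on-mirror)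
    reading : patternWord x₀ (σ · axis k) (M ℕ.* 6) ≡ window (residue x₀) (σ · axis k) ^^ M
    reading = ≡.trans (patternWord-residue x₀ (σ · axis k) (M ℕ.* 6))
                      (patternWord-periodic (residue x₀) (σ · axis k) M)
    residue-geometric : IsGeometric (residue x₀)
    residue-geometric = proj₁ geometric , ≡.trans (classify-≈₆ (residue-≈₆ x₀)) (proj₂ geometric)
    residue-on-mirror : Divisible6 (mirrorDefect (ζ^ (toℕ k)) (residue x₀))
    residue-on-mirror = ≈₆-remainders (≈₆-trans (mirrorDefect-≈₆ (ζ^ (toℕ k)) (residue-≈₆ x₀))
                                                 (on-mirror-≈₆ {γ} {ζ^ (toℕ k)} {t} {x₀} on-mirror))
    window-motif : CyclicEq (window (residue x₀) (σ · axis k)) (motif (kind k))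
    window-motif = motif-everywhere k unit (n%ℕd<d (re x₀) 6) (n%ℕd<d (im x₀) 6)
                                    residue-geometric residue-on-mirror

  ·-⊛ˡ : ∀ x u v → (x · u) ⊛ v ≡ x · (u ⊛ v)
  ·-⊛ˡ x u v = cong₂ _,ω_ (re-law x (re u) (im u) (re v) (im v)) (im-law x (re u) (im u) (re v) (im v))
    where
    re-law : ∀ x a b c d → (x * a) * c - (x * b) * d ≡ x * (a * c - b * d)
    re-law = solve-∀
    im-law : ∀ x a b c d → (x * a) * d + (x * b) * c - (x * b) * d ≡ x * (a * d + b * c - b * d)
    im-law = solve-∀

  ·-⊛ʳ : ∀ x u v → x · (u ⊛ v) ≡ u ⊛ (x · v)
  ·-⊛ʳ x u v = cong₂ _,ω_ (re-law x (re u) (im u) (re v) (im v)) (im-law x (re u) (im u) (re v) (im v))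
    where
    re-law : ∀ x a b c d → x * (a * c - b * d) ≡ a * (x * c) - b * (x * d)
    re-law = solve-∀
    im-law : ∀ x a b c d → x * (a * d + b * c - b * d) ≡ a * (x * d) + b * (x * c) - b * (x * d)
    im-law = solve-∀

  minimal-period : ∀ {γ g x₀ d m n} → MirrorThrough γ g x₀ d m → 1 ≤ n → InL6 γ ((+ n) · d) →
                   (∀ {m′} → 1 ≤ m′ → InL6 γ ((+ m′) · d) → n ≤ m′) → m ≡ n
  minimal-period mirror 1≤n n-period bound =
    ℕₚ.≤-antisym (ℕₚ.≮⇒≥ λ n<m → period-min _ 1≤n n<m n-period) (bound period-pos period)
    where open MirrorThrough mirror

  UnitCoordinate : Zω → Set
  UnitCoordinate u = ∣ re u ∣ ≡ 1 ⊎ ∣ im u ∣ ≡ 1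

  abs-unit-* : ∀ {x} a → Unit x → ∣ x * a ∣ ≡ ∣ a ∣
  abs-unit-* {x} a unit =
    ≡.trans (ℤₚ.abs-* x a) (≡.trans (cong (ℕ._* ∣ a ∣) (abs-unit unit)) (ℕₚ.*-identityˡ ∣ a ∣))
    where
    abs-unit : Unit x → ∣ x ∣ ≡ 1
    abs-unit (inj₁ refl) = refl
    abs-unit (inj₂ refl) = refl

  unit-coordinate-scale : ∀ {x u} → Unit x → UnitCoordinate u → UnitCoordinate (x · u)
  unit-coordinate-scale {u = u} unit (inj₁ ∣a∣≡1) = inj₁ (≡.trans (abs-unit-* (re u) unit) ∣a∣≡1)
  unit-coordinate-scale {u = u} unit (inj₂ ∣b∣≡1) = inj₂ (≡.trans (abs-unit-* (im u) unit) ∣b∣≡1)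

  axis-unit-coordinate : ∀ k → UnitCoordinate (axis k)
  axis-unit-coordinate zero                                = inj₁ refl
  axis-unit-coordinate (suc zero)                          = inj₂ refl
  axis-unit-coordinate (suc (suc zero))                    = inj₁ refl
  axis-unit-coordinate (suc (suc (suc zero)))              = inj₁ refl
  axis-unit-coordinate (suc (suc (suc (suc zero))))        = inj₂ refl
  axis-unit-coordinate (suc (suc (suc (suc (suc zero)))))  = inj₁ refl

  γ₁-generator : ∀ n z → ((+ 6) · γ₁ n) ⊛ z ≡ (+ (n ℕ.* 6)) · z
  γ₁-generator n z = cong₂ _,ω_ (≡.trans (re-law (+ n) (re z) (im z)) (cong (_* re z) 6n))
                                (≡.trans (im-law (+ n) (re z) (im z)) (cong (_* im z) 6n))
    where
    6n : + n * + 6 ≡ + (n ℕ.* 6)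
    6n = ≡.sym (ℤₚ.pos-* n 6)
    re-law : ∀ n a b → (+ 6 * n) * a - (+ 6 * + 0) * b ≡ (n * + 6) * a
    re-law = solve-∀
    im-law : ∀ n a b → (+ 6 * n) * b + (+ 6 * + 0) * a - (+ 6 * + 0) * b ≡ (n * + 6) * b
    im-law = solve-∀

  γ₁-period : ∀ n u → InL6 (γ₁ n) ((+ (n ℕ.* 6)) · u)
  γ₁-period n u = u , ≡.sym (γ₁-generator n u)

  γ₁-period-bound : ∀ n u {m} → UnitCoordinate u → 1 ≤ m → InL6 (γ₁ n) ((+ m) · u) → n ℕ.* 6 ≤ m
  γ₁-period-bound n u {suc m} unit-coordinate _ (z , in-lattice) = ∣⇒≤ (divides-period unit-coordinate)
    where
    scaled : (+ suc m) · u ≡ (+ (n ℕ.* 6)) · z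
    scaled = ≡.trans in-lattice (γ₁-generator n z)
    divides-multiple : ∀ {a c} → + suc m * a ≡ + (n ℕ.* 6) * c → ∣ a ∣ ≡ 1 → n ℕ.* 6 ∣ suc m
    divides-multiple {a} {c} eq ∣a∣≡1 = divides ∣ c ∣ (begin
      suc m                      ≡⟨ ℕₚ.*-identityʳ (suc m) ⟨
      suc m ℕ.* 1                ≡⟨ cong (suc m ℕ.*_) ∣a∣≡1 ⟨
      suc m ℕ.* ∣ a ∣            ≡⟨ ℤₚ.abs-* (+ suc m) a ⟨
      ∣ + suc m * a ∣            ≡⟨ cong ∣_∣ eq ⟩
      ∣ + (n ℕ.* 6) * c ∣        ≡⟨ ℤₚ.abs-* (+ (n ℕ.* 6)) c ⟩
      n ℕ.* 6 ℕ.* ∣ c ∣          ≡⟨ ℕₚ.*-comm (n ℕ.* 6) ∣ c ∣ ⟩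
      ∣ c ∣ ℕ.* (n ℕ.* 6)        ∎)
    divides-period : UnitCoordinate u → n ℕ.* 6 ∣ suc m
    divides-period (inj₁ ∣a∣≡1) = divides-multiple (cong re scaled) ∣a∣≡1
    divides-period (inj₂ ∣b∣≡1) = divides-multiple (cong im scaled) ∣b∣≡1

  γ₂-generator : ∀ b z → ((+ 6) · γ₂ b) ⊛ z ≡ (+ (b ℕ.* 6)) · ((- + 1 ,ω + 1) ⊛ z)
  γ₂-generator b z = cong₂ _,ω_ (≡.trans (re-law (+ b) (re z) (im z)) (cong (_* _) 6b))
                                (≡.trans (im-law (+ b) (re z) (im z)) (cong (_* _) 6b))
    where
    6b : + b * + 6 ≡ + (b ℕ.* 6)
    6b = ≡.sym (ℤₚ.pos-* b 6)
    re-law : ∀ b a c → (+ 6 * - b) * a - (+ 6 * b) * c ≡ (b * + 6) * (- + 1 * a - + 1 * c)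
    re-law = solve-∀
    im-law : ∀ b a c → (+ 6 * - b) * c + (+ 6 * b) * a - (+ 6 * b) * c
                       ≡ (b * + 6) * (- + 1 * c + + 1 * a - + 1 * c)
    im-law = solve-∀

  γ₂⊆γ₁ : ∀ b {y} → InL6 (γ₂ b) y → InL6 (γ₁ b) y
  γ₂⊆γ₁ b (z , in-lattice) =
    (- + 1 ,ω + 1) ⊛ z , ≡.trans in-lattice (≡.trans (γ₂-generator b z) (≡.sym (γ₁-generator b _)))

  γ₂-period : ∀ b w → InL6 (γ₂ b) ((+ (b ℕ.* 6)) · ((- + 1 ,ω + 1) ⊛ w))
  γ₂-period b w = w , ≡.sym (γ₂-generator b w)

  -- (-1 + ω)(2 + ω) = -3, so multiplying by 2 + ω moves the second lattice
  -- into the first lattice for 3b, and 3·6b·u lies in the second lattice.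
  triple : ∀ b → + ((3 ℕ.* b) ℕ.* 6) ≡ + 3 * + (b ℕ.* 6)
  triple b = ≡.trans (cong +_ (ℕₚ.*-assoc 3 b 6)) (ℤₚ.pos-* 3 (b ℕ.* 6))

  γ₂-triple-bound : ∀ b {y} → InL6 (γ₂ b) y → InL6 (γ₁ (3 ℕ.* b)) (y ⊛ (+ 2 ,ω + 1))
  γ₂-triple-bound b {y} (z , in-lattice) = w , (begin
    y ⊛ (+ 2 ,ω + 1)
      ≡⟨ cong (_⊛ (+ 2 ,ω + 1)) (≡.trans in-lattice (γ₂-generator b z)) ⟩
    ((+ (b ℕ.* 6)) · ((- + 1 ,ω + 1) ⊛ z)) ⊛ (+ 2 ,ω + 1)
      ≡⟨ cong₂ _,ω_ (re-law (+ (b ℕ.* 6)) (re z) (im z)) (im-law (+ (b ℕ.* 6)) (re z) (im z)) ⟩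
    (+ 3 * + (b ℕ.* 6)) · w
      ≡⟨ ≡.trans (γ₁-generator (3 ℕ.* b) w) (cong (_· w) (triple b)) ⟨
    ((+ 6) · γ₁ (3 ℕ.* b)) ⊛ w ∎)
    where
    w = (- + 1) · z
    re-law : ∀ N a c →
      (N * (- + 1 * a - + 1 * c)) * + 2 - (N * (- + 1 * c + + 1 * a - + 1 * c)) * + 1
      ≡ (+ 3 * N) * (- + 1 * a)
    re-law = solve-∀
    im-law : ∀ N a c →
      (N * (- + 1 * a - + 1 * c)) * + 1 + (N * (- + 1 * c + + 1 * a - + 1 * c)) * + 2
        - (N * (- + 1 * c + + 1 * a - + 1 * c)) * + 1
      ≡ (+ 3 * N) * (- + 1 * c)
    im-law = solve-∀

  γ₂-triple-period : ∀ b u → InL6 (γ₂ b) ((+ ((3 ℕ.* b) ℕ.* 6)) · u)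
  γ₂-triple-period b u = z , (begin
    (+ ((3 ℕ.* b) ℕ.* 6)) · u
      ≡⟨ cong (_· u) (triple b) ⟩
    (+ 3 * + (b ℕ.* 6)) · u
      ≡⟨ cong₂ _,ω_ (re-law (+ (b ℕ.* 6)) (re u) (im u)) (im-law (+ (b ℕ.* 6)) (re u) (im u)) ⟩
    (+ (b ℕ.* 6)) · ((- + 1 ,ω + 1) ⊛ z)
      ≡⟨ γ₂-generator b z ⟨
    ((+ 6) · γ₂ b) ⊛ z ∎)
    where
    z = (- + 2 ,ω - + 1) ⊛ u
    re-law : ∀ N a c →
      (+ 3 * N) * a
      ≡ N * (- + 1 * (- + 2 * a - - + 1 * c) - + 1 * (- + 2 * c + - + 1 * a - - + 1 * c))
    re-law = solve-∀
    im-law : ∀ N a c →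
      (+ 3 * N) * c
      ≡ N * (- + 1 * (- + 2 * c + - + 1 * a - - + 1 * c) + + 1 * (- + 2 * a - - + 1 * c)
             - + 1 * (- + 2 * c + - + 1 * a - - + 1 * c))
    im-law = solve-∀

  six-fold-positive : ∀ {n} → 1 ≤ n → 1 ≤ n ℕ.* 6
  six-fold-positive {n} 1≤n = ℕₚ.≤-trans 1≤n (ℕₚ.m≤m*n n 6)

  mirror-period₁ : ∀ {b k t x₀ d m} → 1 ≤ b → MirrorThrough (γ₁ b) (sym k true t) x₀ d m →
                   m ≡ b ℕ.* 6
  mirror-period₁ {b} {k} 1≤b mirror with mirror-direction mirror
  ... | σ , unit , refl =
    minimal-period mirror (six-fold-positive 1≤b) (γ₁-period b (σ · axis k))
      (γ₁-period-bound b (σ · axis k) (unit-coordinate-scale unit (axis-unit-coordinate k)))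

  -- The second torus: the edge axes only return to (-1 + ω)Z[ω] after three
  -- lattice steps and close after 18b steps; the altitude axes lie in
  -- (-1 + ω)Z[ω] and close after 6b steps.
  period₂ : MirrorKind → ℕ → ℕ
  period₂ edge-mirror b = 3 ℕ.* b
  period₂ face-mirror b = b

  period₂-positive : ∀ κ {b} → 1 ≤ b → 1 ≤ period₂ κ b
  period₂-positive edge-mirror {b} 1≤b = ℕₚ.≤-trans 1≤b (ℕₚ.m≤n*m b 3)
  period₂-positive face-mirror     1≤b = 1≤b

  AxisProperty : MirrorKind → Zω → Set
  AxisProperty edge-mirror D = UnitCoordinate (D ⊛ (+ 2 ,ω + 1))
  AxisProperty face-mirror D = ∃ λ w → D ≡ (- + 1 ,ω + 1) ⊛ w

  axis-property : ∀ k → AxisProperty (kind k) (axis k)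
  axis-property zero                                = inj₂ refl
  axis-property (suc zero)                          = (- + 1 ,ω - + 1) , refl
  axis-property (suc (suc zero))                    = inj₁ refl
  axis-property (suc (suc (suc zero)))              = (+ 0 ,ω - + 1) , refl
  axis-property (suc (suc (suc (suc zero))))        = inj₁ refl
  axis-property (suc (suc (suc (suc (suc zero)))))  = (- + 1 ,ω + 0) , refl

  mirror-period₂ : ∀ {b k t x₀ d m} → 1 ≤ b → MirrorThrough (γ₂ b) (sym k true t) x₀ d m →
                   m ≡ period₂ (kind k) b ℕ.* 6
  mirror-period₂ {b} {k} {m = m} 1≤b mirror with mirror-direction mirror
  ... | σ , unit , refl = by-kind (kind k) (axis-property k)
    where
    d = σ · axis k
    by-kind : ∀ κ → AxisProperty κ (axis k) → m ≡ period₂ κ b ℕ.* 6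
    by-kind edge-mirror coordinate =
      minimal-period mirror (six-fold-positive (period₂-positive edge-mirror 1≤b))
                     (γ₂-triple-period b d) bound
      where
      turned : UnitCoordinate (d ⊛ (+ 2 ,ω + 1))
      turned = subst UnitCoordinate (≡.sym (·-⊛ˡ σ (axis k) (+ 2 ,ω + 1)))
                     (unit-coordinate-scale unit coordinate)
      bound : ∀ {m′} → 1 ≤ m′ → InL6 (γ₂ b) ((+ m′) · d) → (3 ℕ.* b) ℕ.* 6 ≤ m′
      bound {m′} 1≤m′ in-γ₂ =
        γ₁-period-bound (3 ℕ.* b) (d ⊛ (+ 2 ,ω + 1)) turned 1≤m′
          (subst (InL6 (γ₁ (3 ℕ.* b))) (·-⊛ˡ (+ m′) d (+ 2 ,ω + 1)) (γ₂-triple-bound b in-γ₂))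
    by-kind face-mirror (w , axis≡) =
      minimal-period mirror (six-fold-positive 1≤b) in-γ₂ bound
      where
      in-γ₂ : InL6 (γ₂ b) ((+ (b ℕ.* 6)) · d)
      in-γ₂ = subst (λ v → InL6 (γ₂ b) ((+ (b ℕ.* 6)) · v))
                    (≡.sym (≡.trans (cong (σ ·_) axis≡) (·-⊛ʳ σ (- + 1 ,ω + 1) w)))
                    (γ₂-period b (σ · w))
      bound : ∀ {m′} → 1 ≤ m′ → InL6 (γ₂ b) ((+ m′) · d) → b ℕ.* 6 ≤ m′
      bound 1≤m′ in-γ₂′ =
        γ₁-period-bound b d (unit-coordinate-scale unit (axis-unit-coordinate k)) 1≤m′ (γ₂⊆γ₁ b in-γ₂′)

  first-torus : ∀ {b g x₀ d m} → 1 ≤ b → IsReflection (γ₁ b) g → MirrorThrough (γ₁ b) g x₀ d m →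
                HasPattern (patternWord x₀ d m) (motif (kind (rot g))) b
  first-torus {g = sym k false t} _ reflection _ with IsReflection.orientation-reversing reflection
  ... | ()
  first-torus {g = sym k true t} 1≤b _ mirror with mirror-period₁ 1≤b mirror
  ... | refl = mirror-pattern _ 1≤b mirror

  second-torus : ∀ {b g x₀ d m} → 1 ≤ b → IsReflection (γ₂ b) g → MirrorThrough (γ₂ b) g x₀ d m →
                 HasPattern (patternWord x₀ d m) (motif (kind (rot g))) (period₂ (kind (rot g)) b)
  second-torus {g = sym k false t} _ reflection _ with IsReflection.orientation-reversing reflection
  ... | ()
  second-torus {g = sym k true t} 1≤b _ mirror with mirror-period₂ 1≤b mirror
  ... | refl = mirror-pattern _ (period₂-positive (kind k) 1≤b) mirror

open import Data.Nat using (ℕ; _≤_; _*_)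
open import Data.List using (_∷_; [])
open import Data.Sum using (_⊎_; inj₁; inj₂)
open import Data.Product using (_×_; _,_)
open Mirrors using (edge-mirror; face-mirror; motif; kind; period₂; first-torus; second-torus)

theorem4p2 : (b : ℕ) → 1 ≤ b →
    (∀ g → IsReflection (γ₁ b) g → ∀ x₀ d m → MirrorThrough (γ₁ b) g x₀ d m →
      HasPattern (patternWord x₀ d m) (𝟎 ∷ 𝟏 ∷ []) b
      ⊎ HasPattern (patternWord x₀ d m) (𝟎 ∷ 𝟐 ∷ 𝟏 ∷ 𝟐 ∷ []) b)
    × (∀ g → IsReflection (γ₂ b) g → ∀ x₀ d m → MirrorThrough (γ₂ b) g x₀ d m →
      HasPattern (patternWord x₀ d m) (𝟎 ∷ 𝟏 ∷ []) (3 * b)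
      ⊎ HasPattern (patternWord x₀ d m) (𝟎 ∷ 𝟐 ∷ 𝟏 ∷ 𝟐 ∷ []) b)
theorem4p2 b 1≤b =
  (λ g reflection x₀ d m mirror → on-first (kind (rot g)) (first-torus 1≤b reflection mirror)) ,
  (λ g reflection x₀ d m mirror → on-second (kind (rot g)) (second-torus 1≤b reflection mirror))
  where
  on-first : ∀ {w} κ → HasPattern w (motif κ) b →
             HasPattern w (𝟎 ∷ 𝟏 ∷ []) b ⊎ HasPattern w (𝟎 ∷ 𝟐 ∷ 𝟏 ∷ 𝟐 ∷ []) b
  on-first edge-mirror = inj₁
  on-first face-mirror = inj₂
  on-second : ∀ {w} κ → HasPattern w (motif κ) (period₂ κ b) →
              HasPattern w (𝟎 ∷ 𝟏 ∷ []) (3 * b) ⊎ HasPattern w (𝟎 ∷ 𝟐 ∷ 𝟏 ∷ 𝟐 ∷ []) b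
  on-second edge-mirror = inj₁
  on-second face-mirror = inj₂
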